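{- Let $n,k$ be integers with $k\ge1$, $n>2k$, and $n$ odd. Then $\beta(P(n,k))\ge n+1$.
   Context: $P(n,k)$ is the generalized Petersen graph with vertices $u_1,\dots,u_n,v_1,\dots,v_n$ and edges $u_iu_{i+1}$, $u_iv_i$, $v_iv_{i+k}$ (subscripts modulo $n$). $\beta(G)$ denotes the size of a minimum vertex cover of $G$. -}

module Defs where

open import Data.Nat using (ℕ; zero; suc; _+_; _%_; NonZero)
open import Data.Nat.DivMod using (m%n<n)
open import Data.Fin using (Fin; toℕ; fromℕ<)
open import Data.Bool using (Bool; true; false; T; _∨_)
open import Data.Sum using (_⊎_; inj₁; inj₂)
open import Data.Product using (_×_)
open import Data.List using (List; length; filter; map)
open import Data.List using (allFin)
open import Data.Bool.Properties using (T?)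

_+ₘ_ : ∀ {n} → Fin n → ℕ → Fin n
_+ₘ_ {zero} () _
_+ₘ_ {suc n} i k = fromℕ< (m%n<n (toℕ i + k) (suc n))

-- vertices of P(n,k): inj₁ i = u_i, inj₂ i = v_i
Vertex : ℕ → Set
Vertex n = Fin n ⊎ Fin n

VSet : ℕ → Set
VSet n = Vertex n → Bool

Covers : ∀ {n} → VSet n → Vertex n → Vertex n → Set
Covers C a b = T (C a ∨ C b)

IsVertexCoverP : (n k : ℕ) → VSet n → Set
IsVertexCoverP n k C =
  (i : Fin n) →
    Covers C (inj₁ i) (inj₁ (i +ₘ 1)) ×
    Covers C (inj₁ i) (inj₂ i) ×
    Covers C (inj₂ i) (inj₂ (i +ₘ k))

card : ∀ {n} → VSet n → ℕ
card {n} C = length (filter (λ i → T? (C (inj₁ i))) (allFin n))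
           + length (filter (λ i → T? (C (inj₂ i))) (allFin n))

module Submission where

-- Write A and B for the numbers of outer vertices u_i and inner
-- vertices v_i in a vertex cover C of P(n,k).  The outer edges u_i u_{i+1} and
-- the inner edges v_i v_{i+k} are both of the form {i, i+m} for i ranging over
-- Z_n, and i ↦ i+m is a permutation of Z_n.  Summing "edge {i,i+m} is covered"
-- over all i therefore counts every chosen vertex exactly twice, so n ≤ 2A and
-- n ≤ 2B.  As n is odd these inequalities are strict: n+1 ≤ 2A and n+1 ≤ 2B,
-- and adding them gives n+1 ≤ A+B = |C|.

open import Defs
open import Data.Nat using (ℕ; _≤_; _<_; _*_; _+_; _%_)
open import Relation.Binary.PropositionalEquality using (_≡_)

open import Data.Nat using (zero; suc; _∸_; _/_; NonZero; z≤n; s≤s)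
open import Data.Nat.Properties
open import Data.Nat.DivMod using (m≡m%n+[m/n]*n; m%n%n≡m%n; %-distribˡ-+; [m+kn]%n≡m%n; m<n⇒m%n≡m; m%n≤n; n%n≡0; m*n%n≡0)
open import Data.Fin using (Fin; toℕ)
open import Data.Fin.Properties using (toℕ-fromℕ<; toℕ-injective; toℕ<n)
open import Data.Fin.Permutation using (permutation)
open import Data.Bool using (Bool; true; false)
open import Data.Bool.Properties using (T?)
open import Data.Sum using (inj₁; inj₂)
open import Data.Product using (proj₁; proj₂)
open import Data.List using (length; filter; tabulate)
open import Data.Empty using (⊥-elim)
open import Relation.Nullary using (¬_)
open import Relation.Binary.PropositionalEquality using (refl; sym; trans; cong; cong₂; module ≡-Reasoning)
open import Algebra.Properties.CommutativeMonoid.Sum +-0-commutativeMonoid using (sum; sum-permute; ∑-distrib-+)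
open import Algebra.Properties.CommutativeSemigroup +-commutativeSemigroup using (interchange)

indicator : Bool → ℕ
indicator true  = 1
indicator false = 0

length-filter-tabulate : ∀ {m n} (f : Fin m → Fin n) (p : Fin n → Bool) →
  length (filter (λ i → T? (p i)) (tabulate f)) ≡ sum (λ j → indicator (p (f j)))
length-filter-tabulate {zero}  f p = refl
length-filter-tabulate {suc m} f p with p (f Fin.zero)
... | true  = cong suc (length-filter-tabulate (λ j → f (Fin.suc j)) p)
... | false = length-filter-tabulate (λ j → f (Fin.suc j)) p

card-as-sums : ∀ {n} (C : VSet n) →
  card C ≡ sum (λ i → indicator (C (inj₁ i))) + sum (λ i → indicator (C (inj₂ i)))
card-as-sums C = cong₂ _+_ (length-filter-tabulate (λ i → i) (λ i → C (inj₁ i)))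
                           (length-filter-tabulate (λ i → i) (λ i → C (inj₂ i)))

covered-edge : ∀ {n} (C : VSet n) a b → Covers C a b → 1 ≤ indicator (C a) + indicator (C b)
covered-edge C a b covered with C a | C b
... | true  | _     = s≤s z≤n
... | false | true  = s≤s z≤n
... | false | false = ⊥-elim covered

sum-mono : ∀ {n} {f g : Fin n → ℕ} → (∀ i → f i ≤ g i) → sum f ≤ sum g
sum-mono {zero}  f≤g = z≤n
sum-mono {suc n} f≤g = +-mono-≤ (f≤g Fin.zero) (sum-mono (λ i → f≤g (Fin.suc i)))

sum-ones : ∀ n → sum {n} (λ _ → 1) ≡ n
sum-ones zero    = refl
sum-ones (suc n) = cong suc (sum-ones n)

toℕ-+ₘ : ∀ {N} (i : Fin (suc N)) a → toℕ (i +ₘ a) ≡ (toℕ i + a) % suc N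
toℕ-+ₘ i a = toℕ-fromℕ< _

%-absorbˡ : ∀ x b d .{{_ : NonZero d}} → (x % d + b) % d ≡ (x + b) % d
%-absorbˡ x b d = begin
  (x % d + b) % d             ≡⟨ %-distribˡ-+ (x % d) b d ⟩
  (x % d % d + b % d) % d     ≡⟨ cong (λ z → (z + b % d) % d) (m%n%n≡m%n x d) ⟩
  (x % d + b % d) % d         ≡⟨ sym (%-distribˡ-+ x b d) ⟩
  (x + b) % d                 ∎
  where open ≡-Reasoning

rotate-inverse : ∀ {N} (i : Fin (suc N)) a b → (a + b) % suc N ≡ 0 → (i +ₘ a) +ₘ b ≡ i
rotate-inverse {N} i a b a+b≡0 = toℕ-injective (begin
    toℕ ((i +ₘ a) +ₘ b)           ≡⟨ toℕ-+ₘ (i +ₘ a) b ⟩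
    (toℕ (i +ₘ a) + b) % n        ≡⟨ cong (λ z → (z + b) % n) (toℕ-+ₘ i a) ⟩
    ((toℕ i + a) % n + b) % n     ≡⟨ %-absorbˡ (toℕ i + a) b n ⟩
    (toℕ i + a + b) % n           ≡⟨ cong (_% n) (+-assoc (toℕ i) a b) ⟩
    (toℕ i + (a + b)) % n         ≡⟨ cong (λ z → (toℕ i + z) % n) a+b≡multiple ⟩
    (toℕ i + (a + b) / n * n) % n ≡⟨ [m+kn]%n≡m%n (toℕ i) ((a + b) / n) n ⟩
    toℕ i % n                     ≡⟨ m<n⇒m%n≡m (toℕ<n i) ⟩
    toℕ i                         ∎)
  where
  open ≡-Reasoning
  n = suc N
  a+b≡multiple : a + b ≡ (a + b) / n * n
  a+b≡multiple = trans (m≡m%n+[m/n]*n (a + b) n) (cong (_+ (a + b) / n * n) a+b≡0)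

-- m + (n ∸ m % n) is a multiple of n: the rotation by n ∸ m % n undoes the rotation by m.
complement-mod : ∀ N m → (m + (suc N ∸ m % suc N)) % suc N ≡ 0
complement-mod N m = begin
  (m + (n ∸ m % n)) % n          ≡⟨ sym (%-absorbˡ m (n ∸ m % n) n) ⟩
  (m % n + (n ∸ m % n)) % n      ≡⟨ cong (_% n) (m+[n∸m]≡n (m%n≤n m n)) ⟩
  n % n                          ≡⟨ n%n≡0 n ⟩
  0                              ∎
  where
  open ≡-Reasoning
  n = suc N

sum-rotate : ∀ {N} (g : Fin (suc N) → ℕ) m → sum (λ i → g (i +ₘ m)) ≡ sum g
sum-rotate {N} g m = sym (sum-permute g rotation)
  where
  m⁻¹ = suc N ∸ m % suc N
  rotation = permutation (λ i → i +ₘ m) (λ i → i +ₘ m⁻¹)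
    (λ i → rotate-inverse i m⁻¹ m (trans (cong (_% suc N) (+-comm m⁻¹ m)) (complement-mod N m)))
    (λ i → rotate-inverse i m m⁻¹ (complement-mod N m))

circulant-bound : ∀ {n} (x : Fin n → ℕ) m → (∀ i → 1 ≤ x i + x (i +ₘ m)) → n ≤ sum x + sum x
circulant-bound {zero}  x m edge = z≤n
circulant-bound {suc N} x m edge = begin
  suc N                          ≡⟨ sym (sum-ones (suc N)) ⟩
  sum {suc N} (λ _ → 1)          ≤⟨ sum-mono edge ⟩
  sum (λ i → x i + x (i +ₘ m))   ≡⟨ ∑-distrib-+ x (λ i → x (i +ₘ m)) ⟩
  sum x + sum (λ i → x (i +ₘ m)) ≡⟨ cong (sum x +_) (sum-rotate x m) ⟩
  sum x + sum x                  ∎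
  where open ≤-Reasoning

odd≢double : ∀ n a → n % 2 ≡ 1 → ¬ (n ≡ a + a)
odd≢double n a odd n≡a+a = 0≢1+n (begin
  0             ≡⟨ sym (m*n%n≡0 a 2) ⟩
  (a * 2) % 2   ≡⟨ cong (_% 2) (trans (*-comm a 2) (cong (a +_) (+-identityʳ a))) ⟩
  (a + a) % 2   ≡⟨ cong (_% 2) (sym n≡a+a) ⟩
  n % 2         ≡⟨ odd ⟩
  1             ∎)
  where open ≡-Reasoning

odd-below-double : ∀ n a → n % 2 ≡ 1 → n ≤ a + a → n + 1 ≤ a + a
odd-below-double n a odd n≤2a rewrite +-comm n 1 =
  ≤∧≢⇒< n≤2a (odd≢double n a odd)

below-average : ∀ m a b → m ≤ a + a → m ≤ b + b → m ≤ a + b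
below-average m a b m≤2a m≤2b = ≮⇒≥ λ a+b<m →
  <⇒≱ (+-mono-< a+b<m a+b<m) (begin
    m + m                ≤⟨ +-mono-≤ m≤2a m≤2b ⟩
    (a + a) + (b + b)    ≡⟨ interchange a a b b ⟩
    (a + b) + (a + b)    ∎)
  where open ≤-Reasoning

corollary8 : (n k : ℕ) → 1 ≤ k → 2 * k < n → n % 2 ≡ 1 →
    (C : VSet n) → IsVertexCoverP n k C → n + 1 ≤ card C
corollary8 n k _ _ odd C cover
  rewrite card-as-sums C = below-average (n + 1) outer inner outer-bound inner-bound
  where
  outer = sum (λ i → indicator (C (inj₁ i)))
  inner = sum (λ i → indicator (C (inj₂ i)))
  outer-bound : n + 1 ≤ outer + outer
  outer-bound = odd-below-double n outer odd
    (circulant-bound _ 1 (λ i → covered-edge C _ _ (proj₁ (cover i))))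
  inner-bound : n + 1 ≤ inner + inner
  inner-bound = odd-below-double n inner odd
    (circulant-bound _ k (λ i → covered-edge C _ _ (proj₂ (proj₂ (cover i)))))
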